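{- Let $\mathcal{V}$ be a $d$-TVASS, $\beta$ a cycle on a state $q$, and $q(\vec{x})$ a configuration such that the linear path scheme $\beta^*$ is bounded from $q(\vec{x})$. Then every configuration $q(\vec{y})$ such that $q(\vec{x})\xrightarrow{\beta^n}q(\vec{y})$ for some $n\geq 2$ satisfies $\|\vec{y}\|\leq (1+\|\Delta(\beta)\|)\,\|\vec{x}\|$.
   Context: A $d$-TVASS is a triple $\mathcal{V}=(Q,\Sigma,\Delta)$ with $Q$ a finite set of states, $\Sigma\subseteq\mathbb{Z}^d\cup\{\mathtt{tst}\}$ a finite set of actions, $\Delta\subseteq Q\times\Sigma\times Q$ a finite set of transitions. Configurations are $q(\vec{x})$ with $\vec{x}\in\mathbb{N}^d$. An addition transition $(p,\vec{a},q)$ gives a step $p(\vec{x})\to q(\vec{x}+\vec{a})$ if $\vec{x}+\vec{a}\in\mathbb{N}^d$; a zero-test transition $(p,\mathtt{tst},q)$ gives a step $p(\vec{x})\to q(\vec{x})$ if $\vec{x}(1)=0$. A path is a finite sequence of consecutive transitions, a cycle is a path starting and ending in the same state, and $p(\vec{x})\xrightarrow{\pi}q(\vec{y})$ means $\pi$ can be executed from $p(\vec{x})$ reaching $q(\vec{y})$. The displacement $\Delta(\pi)\in\mathbb{Z}^d$ of a path is the sum of the addition vectors of its transitions (zero-tests contribute $\vec{0}$). $\|\cdot\|$ is the max norm. A linear path scheme $L$ (such as $\beta^*$, whose language is $\{\beta^n\mid n\in\mathbb{N}\}$) is bounded from a configuration $p(\vec{x})$ if the set of configurations $r(\vec{z})$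 such that $p(\vec{x})\xrightarrow{\pi}r(\vec{z})$ for some prefix $\pi$ of a path in the language of $L$ is finite. -}

module Defs where

open import Data.Nat using (ℕ; zero; suc; _⊔_; _+_; _*_; _≤_)
open import Data.Integer as ℤ using (ℤ; ∣_∣)
open import Data.Fin using (Fin)
open import Data.Vec as Vec using (Vec; []; _∷_; zipWith; foldr)
open import Data.List using (List; []; _∷_; _++_; concat; replicate)
open import Data.List.Membership.Propositional using (_∈_)
open import Data.Product using (_×_; _,_; ∃; ∃-syntax; Σ-syntax)
open import Data.Unit using (⊤)
open import Relation.Binary.PropositionalEquality using (_≡_)

‖_‖ℕ : ∀ {d} → Vec ℕ d → ℕ
‖ x ‖ℕ = foldr _ _⊔_ 0 x

‖_‖ℤ : ∀ {d} → Vec ℤ d → ℕ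
‖ a ‖ℤ = foldr _ (λ z m → ∣ z ∣ ⊔ m) 0 a

FirstZero : ∀ {d} → Vec ℕ d → Set
FirstZero []      = ⊤
FirstZero (x ∷ _) = x ≡ 0

data Action (d : ℕ) : Set where
  add : Vec ℤ d → Action d
  tst : Action d

-- A d-TVASS: finite state set Q = Fin nQ, finite set of transitions
-- Δ ⊆ Q × Σ × Q given as a list (Σ = the actions occurring in Δ).
record TVASS (d : ℕ) : Set where
  field
    nQ : ℕ
    Δ  : List (Fin nQ × Action d × Fin nQ)

data Step {d : ℕ} : Vec ℕ d → Action d → Vec ℕ d → Set where
  -- y = x + a (y ∈ ℕ^d is the requirement x + a ∈ ℕ^d)
  stepAdd : ∀ {x y} (a : Vec ℤ d) →
            zipWith (λ n z → ℤ.+ n ℤ.+ z) x a ≡ Vec.map ℤ.+_ y →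
            Step x (add a) y
  stepTst : ∀ {x} → FirstZero x → Step x tst x

dispA : ∀ {d} → Action d → Vec ℤ d
dispA (add a) = a
dispA tst     = Vec.replicate _ (ℤ.+ 0)

module _ {d : ℕ} (V : TVASS d) where
  open TVASS V

  State : Set
  State = Fin nQ

  Transition : Set
  Transition = State × Action d × State

  Path : Set
  Path = List Transition

  data IsPath : State → Path → State → Set where
    nil  : ∀ {p} → IsPath p [] p
    cons : ∀ {p a r q π} → (p , a , r) ∈ Δ → IsPath r π q →
           IsPath p ((p , a , r) ∷ π) q

  IsCycleOn : Path → State → Set
  IsCycleOn β q = IsPath q β q

  data Run : Vec ℕ d → Path → Vec ℕ d → Set where
    nil  : ∀ {x} → Run x [] x
    cons : ∀ {x y z p a r π} → Step x a y → Run y π z →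
           Run x ((p , a , r) ∷ π) z

  Reach : State → Vec ℕ d → Path → State → Vec ℕ d → Set
  Reach p x π q y = IsPath p π q × Run x π y

  disp : Path → Vec ℤ d
  disp []              = Vec.replicate _ (ℤ.+ 0)
  disp ((_ , a , _) ∷ π) = zipWith ℤ._+_ (dispA a) (disp π)

  _^_ : Path → ℕ → Path
  β ^ n = concat (replicate n β)

  -- The linear path scheme β* is bounded from p(x): the set of
  -- configurations r(z) with p(x) --π--> r(z) for some prefix π of some
  -- β^n is finite, i.e. contained in some finite list.
  BoundedFrom : Path → State → Vec ℕ d → Set
  BoundedFrom β p x =
    ∃[ L ] (∀ (n : ℕ) (π ρ : Path) (r : State) (z : Vec ℕ d) →
              π ++ ρ ≡ β ^ n → Reach p x π r z →
              _∈_ {A = State × Vec ℕ d} (r , z) L)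

module Submission where

-- Every run of β^n changes counter i by exactly n·Δ(β)(i) (runPow).
-- We split on the signs of the entries of Δ = Δ(β) (negativeOrNatural).
--   * Some Δ(j) < 0.  Counter j stays non-negative, so n ≤ x(j) ≤ ‖x‖,
--     and y(i) ≤ x(i) + n·|Δ(i)| ≤ (1 + ‖Δ‖)·‖x‖ (decreasingCycleBound).
--   * Δ = c ∈ ℕ^d.  The first two iterations run x → x+c → x₂.  A run
--     possible from a and from a+c is possible from every a+m·c, since
--     a zero-test passed from both forces c(1) = 0 (runRay).  Hence β^k
--     runs from x to x+k·c for every k (pump); boundedness of β* forces
--     c = 0, so y = x (naturalCycleStationary).

open import Defs
open import Data.Nat using (ℕ; zero; suc; _≤_; _+_; _*_; z≤n; s≤s)
import Data.Nat.Properties as ℕP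
open import Data.Integer as ℤ using (ℤ; +_; -[1+_]; ∣_∣)
import Data.Integer.Properties as ℤP
open import Data.Integer.Tactic.RingSolver using (solve-∀)
open import Data.Fin using (zero; suc)
open import Data.Vec as Vec using (Vec; []; _∷_; lookup; zipWith)
import Data.Vec.Properties as VecP
open import Data.Vec.Relation.Binary.Pointwise.Extensional using (ext; Pointwise-≡⇒≡)
open import Data.List as List using (List; []; _∷_; _++_)
import Data.List.Properties as ListP
open import Data.List.Extrema.Nat using (max; xs≤max)
import Data.List.Relation.Unary.All as All
open import Data.List.Membership.Propositional.Properties using (∈-map⁺)
open import Data.Product using (∃; ∃₂; _×_; _,_; proj₂)
open import Data.Sum using (_⊎_; inj₁; inj₂)
open import Relation.Nullary using (contradiction)
open import Relation.Binary.PropositionalEquality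

lookup≤‖‖ℕ : ∀ {d} (x : Vec ℕ d) i → lookup x i ≤ ‖ x ‖ℕ
lookup≤‖‖ℕ (a ∷ x) zero    = ℕP.m≤m⊔n a _
lookup≤‖‖ℕ (a ∷ x) (suc i) = ℕP.≤-trans (lookup≤‖‖ℕ x i) (ℕP.m≤n⊔m a _)

∣lookup∣≤‖‖ℤ : ∀ {d} (v : Vec ℤ d) i → ∣ lookup v i ∣ ≤ ‖ v ‖ℤ
∣lookup∣≤‖‖ℤ (a ∷ v) zero    = ℕP.m≤m⊔n ∣ a ∣ _
∣lookup∣≤‖‖ℤ (a ∷ v) (suc i) = ℕP.≤-trans (∣lookup∣≤‖‖ℤ v i) (ℕP.m≤n⊔m ∣ a ∣ _)

‖‖ℕ-lub : ∀ {d} (x : Vec ℕ d) {B} → (∀ i → lookup x i ≤ B) → ‖ x ‖ℕ ≤ B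
‖‖ℕ-lub []      h = z≤n
‖‖ℕ-lub (a ∷ x) h = ℕP.⊔-lub (h zero) (‖‖ℕ-lub x (λ i → h (suc i)))

vecExt : ∀ {A : Set} {d} {u v : Vec A d} → (∀ i → lookup u i ≡ lookup v i) → u ≡ v
vecExt h = Pointwise-≡⇒≡ (ext h)

infixl 6 _⊕_
infixr 7 _·_

_⊕_ : ∀ {d} → Vec ℕ d → Vec ℕ d → Vec ℕ d
u ⊕ v = zipWith _+_ u v

_·_ : ∀ {d} → ℕ → Vec ℕ d → Vec ℕ d
m · c = Vec.map (m *_) c

lookup-⊕ : ∀ {d} (u v : Vec ℕ d) i → lookup (u ⊕ v) i ≡ lookup u i + lookup v i
lookup-⊕ u v i = VecP.lookup-zipWith _+_ i u v

lookup-· : ∀ {d} m (c : Vec ℕ d) i → lookup (m · c) i ≡ m * lookup c i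
lookup-· m c i = VecP.lookup-map i (m *_) c

ray-zero : ∀ {d} (x c : Vec ℕ d) → x ⊕ 0 · c ≡ x
ray-zero x c = vecExt λ i → begin
  lookup (x ⊕ 0 · c) i           ≡⟨ lookup-⊕ x (0 · c) i ⟩
  lookup x i + lookup (0 · c) i  ≡⟨ cong (λ w → lookup x i + w) (lookup-· 0 c i) ⟩
  lookup x i + 0                 ≡⟨ ℕP.+-identityʳ _ ⟩
  lookup x i                     ∎
  where open ≡-Reasoning

ray-suc : ∀ {d} (x c : Vec ℕ d) m → (x ⊕ c) ⊕ m · c ≡ x ⊕ suc m · c
ray-suc x c m = vecExt λ i → begin
  lookup ((x ⊕ c) ⊕ m · c) i                  ≡⟨ lookup-⊕ (x ⊕ c) (m · c) i ⟩
  lookup (x ⊕ c) i + lookup (m · c) i         ≡⟨ cong₂ _+_ (lookup-⊕ x c i) (lookup-· m c i) ⟩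
  (lookup x i + lookup c i) + m * lookup c i  ≡⟨ ℕP.+-assoc (lookup x i) _ _ ⟩
  lookup x i + suc m * lookup c i             ≡⟨ cong (λ w → lookup x i + w) (sym (lookup-· (suc m) c i)) ⟩
  lookup x i + lookup (suc m · c) i           ≡⟨ sym (lookup-⊕ x (suc m · c) i) ⟩
  lookup (x ⊕ suc m · c) i                    ∎
  where open ≡-Reasoning

Displaced : ∀ {d} → Vec ℕ d → Vec ℤ d → Vec ℕ d → Set
Displaced x a y = ∀ i → + lookup y i ≡ + lookup x i ℤ.+ lookup a i

addStep⇒Displaced : ∀ {d} {x y : Vec ℕ d} {a : Vec ℤ d} →
  zipWith (λ n z → + n ℤ.+ z) x a ≡ Vec.map +_ y → Displaced x a y
addStep⇒Displaced {x = x} {y} {a} eq i = begin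
  + lookup y i                           ≡⟨ sym (VecP.lookup-map i +_ y) ⟩
  lookup (Vec.map +_ y) i                ≡⟨ cong (λ v → lookup v i) (sym eq) ⟩
  lookup (zipWith _ x a) i               ≡⟨ VecP.lookup-zipWith _ i x a ⟩
  + lookup x i ℤ.+ lookup a i            ∎
  where open ≡-Reasoning

Displaced⇒addStep : ∀ {d} {x y : Vec ℕ d} {a : Vec ℤ d} →
  Displaced x a y → zipWith (λ n z → + n ℤ.+ z) x a ≡ Vec.map +_ y
Displaced⇒addStep {x = x} {y} {a} h = vecExt λ i →
  trans (VecP.lookup-zipWith _ i x a) (trans (sym (h i)) (sym (VecP.lookup-map i +_ y)))

Displaced-⊕ : ∀ {d} {x y : Vec ℕ d} {a : Vec ℤ d} → Displaced x a y →
  ∀ u → Displaced (x ⊕ u) a (y ⊕ u)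
Displaced-⊕ {x = x} {y} {a} h u i = begin
  + lookup (y ⊕ u) i                          ≡⟨ cong +_ (lookup-⊕ y u i) ⟩
  + (lookup y i + lookup u i)                 ≡⟨ ℤP.pos-+ (lookup y i) _ ⟩
  + lookup y i ℤ.+ + lookup u i               ≡⟨ cong (ℤ._+ + lookup u i) (h i) ⟩
  (+ lookup x i ℤ.+ lookup a i) ℤ.+ + lookup u i  ≡⟨ swap (+ lookup x i) (lookup a i) (+ lookup u i) ⟩
  (+ lookup x i ℤ.+ + lookup u i) ℤ.+ lookup a i  ≡⟨ cong (ℤ._+ lookup a i) (sym (ℤP.pos-+ (lookup x i) _)) ⟩
  + (lookup x i + lookup u i) ℤ.+ lookup a i  ≡⟨ cong (λ w → + w ℤ.+ lookup a i) (sym (lookup-⊕ x u i)) ⟩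
  + lookup (x ⊕ u) i ℤ.+ lookup a i           ∎
  where
  open ≡-Reasoning
  swap : ∀ p q r → (p ℤ.+ q) ℤ.+ r ≡ (p ℤ.+ r) ℤ.+ q
  swap = solve-∀

firstZero-ray : ∀ {d} (a c : Vec ℕ d) m → FirstZero a → FirstZero (a ⊕ c) →
  FirstZero (a ⊕ m · c)
firstZero-ray []      []      m _    _     = _
firstZero-ray (_ ∷ _) (c ∷ _) m refl c≡0 rewrite c≡0 = ℕP.*-zeroʳ m

stepRay : ∀ {d} {a a′ c b : Vec ℕ d} {t : Action d} → Step a t a′ → Step (a ⊕ c) t b →
  b ≡ a′ ⊕ c × (∀ m → Step (a ⊕ m · c) t (a′ ⊕ m · c))
stepRay {a = a} {a′} {c} {b} (stepAdd t e₁) (stepAdd .t e₂) =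
    vecExt (λ i → ℤP.+-injective (trans (d₂ i) (sym (Displaced-⊕ {x = a} {a′} {t} d₁ c i))))
  , λ m → stepAdd t (Displaced⇒addStep (Displaced-⊕ {x = a} {a′} {t} d₁ (m · c)))
  where
  d₁ : Displaced a t a′
  d₁ = addStep⇒Displaced e₁
  d₂ : Displaced (a ⊕ c) t b
  d₂ = addStep⇒Displaced e₂
stepRay {a = a} {c = c} (stepTst f₁) (stepTst f₂) =
  refl , λ m → stepTst (firstZero-ray a c m f₁ f₂)

iterations≤counter : ∀ y x n k → + y ≡ + x ℤ.+ + n ℤ.* -[1+ k ] → n ≤ x
iterations≤counter y x n k h = begin
  n                  ≤⟨ ℕP.m≤m*n n (suc k) ⟩
  n * suc k          ≤⟨ ℕP.m≤n+m (n * suc k) y ⟩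
  y + n * suc k      ≡⟨ ℤP.+-injective total ⟩
  x                  ∎
  where
  open ℕP.≤-Reasoning
  cancel : ∀ X N S → (X ℤ.+ N ℤ.* ℤ.- S) ℤ.+ N ℤ.* S ≡ X
  cancel = solve-∀
  total : + (y + n * suc k) ≡ + x
  total = trans (ℤP.pos-+ y (n * suc k))
    (trans (cong₂ ℤ._+_ h (ℤP.pos-* n (suc k))) (cancel (+ x) (+ n) (+ suc k)))

drift≤ : ∀ y x n D → + y ≡ + x ℤ.+ + n ℤ.* D → y ≤ x + n * ∣ D ∣
drift≤ y x n D h = begin
  y                       ≡⟨ cong ∣_∣ h ⟩
  ∣ + x ℤ.+ + n ℤ.* D ∣   ≤⟨ ℤP.∣i+j∣≤∣i∣+∣j∣ (+ x) (+ n ℤ.* D) ⟩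
  x + ∣ + n ℤ.* D ∣       ≡⟨ cong (λ w → x + w) (ℤP.∣i*j∣≡∣i∣*∣j∣ (+ n) D) ⟩
  x + n * ∣ D ∣           ∎
  where open ℕP.≤-Reasoning

multiplesBounded : ∀ c M → suc M * c ≤ M → c ≡ 0
multiplesBounded zero    M _ = refl
multiplesBounded (suc c) M h =
  contradiction (ℕP.≤-trans (ℕP.m≤m*n (suc M) (suc c)) h) (ℕP.n≮n M)

negativeOrNatural : ∀ {d} (v : Vec ℤ d) →
  (∃₂ λ j k → lookup v j ≡ -[1+ k ]) ⊎ (∃ λ c → v ≡ Vec.map +_ c)
negativeOrNatural []             = inj₂ ([] , refl)
negativeOrNatural (-[1+ k ] ∷ v) = inj₁ (zero , k , refl)
negativeOrNatural (+ n ∷ v) with negativeOrNatural v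
... | inj₁ (j , k , vj≡) = inj₁ (suc j , k , vj≡)
... | inj₂ (c , v≡c)     = inj₂ (n ∷ c , cong (+ n ∷_) v≡c)

module _ {d : ℕ} (𝒱 : TVASS d) where

  _^ₚ_ : Path 𝒱 → ℕ → Path 𝒱
  β ^ₚ k = _^_ 𝒱 β k

  run-++ : ∀ {x y z π ρ} → Run 𝒱 x π y → Run 𝒱 y ρ z → Run 𝒱 x (π ++ ρ) z
  run-++ nil         r = r
  run-++ (cons s r₁) r = cons s (run-++ r₁ r)

  run-split : ∀ π {ρ x z} → Run 𝒱 x (π ++ ρ) z → ∃ λ y → Run 𝒱 x π y × Run 𝒱 y ρ z
  run-split []      r          = _ , nil , r
  run-split (_ ∷ π) (cons s r) with run-split π r
  ... | y , r₁ , r₂ = y , cons s r₁ , r₂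

  path-++ : ∀ {p π r ρ s} → IsPath 𝒱 p π r → IsPath 𝒱 r ρ s → IsPath 𝒱 p (π ++ ρ) s
  path-++ nil        q = q
  path-++ (cons t p) q = cons t (path-++ p q)

  path-pow : ∀ {β q} → IsCycleOn 𝒱 β q → ∀ k → IsPath 𝒱 q (β ^ₚ k) q
  path-pow c zero    = nil
  path-pow c (suc k) = path-++ c (path-pow c k)

  runDisplaced : ∀ {x π y} → Run 𝒱 x π y → Displaced x (disp 𝒱 π) y
  runDisplaced {x} nil i = begin
    + lookup x i                                 ≡⟨ sym (ℤP.+-identityʳ _) ⟩
    + lookup x i ℤ.+ + 0                         ≡⟨ cong (λ w → + lookup x i ℤ.+ w) (sym (VecP.lookup-replicate i (+ 0))) ⟩
    + lookup x i ℤ.+ lookup (disp 𝒱 []) i        ∎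
    where open ≡-Reasoning
  runDisplaced {x} {(p , t , q) ∷ π} {y} (cons {y = x₁} s r) i = begin
    + lookup y i                           ≡⟨ runDisplaced r i ⟩
    + lookup x₁ i ℤ.+ P                    ≡⟨ cong (ℤ._+ P) (stepDisplaced s i) ⟩
    (+ lookup x i ℤ.+ A) ℤ.+ P             ≡⟨ ℤP.+-assoc (+ lookup x i) A P ⟩
    + lookup x i ℤ.+ (A ℤ.+ P)             ≡⟨ cong (λ w → + lookup x i ℤ.+ w) (sym (VecP.lookup-zipWith ℤ._+_ i (dispA t) (disp 𝒱 π))) ⟩
    + lookup x i ℤ.+ lookup (disp 𝒱 ((p , t , q) ∷ π)) i  ∎
    where
    open ≡-Reasoning
    A P : ℤ
    A = lookup (dispA t) i
    P = lookup (disp 𝒱 π) i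
    stepDisplaced : ∀ {a b : Vec ℕ d} {t} → Step a t b → Displaced a (dispA t) b
    stepDisplaced (stepAdd t e) = addStep⇒Displaced e
    stepDisplaced {a} (stepTst _) j rewrite VecP.lookup-replicate j (+ 0) = sym (ℤP.+-identityʳ (+ lookup a j))

  runPow : ∀ β n {x y} → Run 𝒱 x (β ^ₚ n) y → ∀ i →
           + lookup y i ≡ + lookup x i ℤ.+ + n ℤ.* lookup (disp 𝒱 β) i
  runPow β zero    {x} nil i = sym (ℤP.+-identityʳ (+ lookup x i))
  runPow β (suc n) {x} {y} r i with run-split β r
  ... | x₁ , r₁ , r₂ = begin
    + lookup y i                                  ≡⟨ runPow β n r₂ i ⟩
    + lookup x₁ i ℤ.+ + n ℤ.* D                   ≡⟨ cong (ℤ._+ + n ℤ.* D) (runDisplaced r₁ i) ⟩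
    (+ lookup x i ℤ.+ D) ℤ.+ + n ℤ.* D            ≡⟨ collect (+ lookup x i) D (+ n) ⟩
    + lookup x i ℤ.+ (ℤ.1ℤ ℤ.+ + n) ℤ.* D         ∎
    where
    open ≡-Reasoning
    D : ℤ
    D = lookup (disp 𝒱 β) i
    collect : ∀ X D N → (X ℤ.+ D) ℤ.+ N ℤ.* D ≡ X ℤ.+ (ℤ.1ℤ ℤ.+ N) ℤ.* D
    collect = solve-∀

  runNatural : ∀ {π x y} {c : Vec ℕ d} → disp 𝒱 π ≡ Vec.map +_ c → Run 𝒱 x π y → y ≡ x ⊕ c
  runNatural {π} {x} {y} {c} Δ≡c r = vecExt λ i → ℤP.+-injective (begin
    + lookup y i                           ≡⟨ runDisplaced r i ⟩
    + lookup x i ℤ.+ lookup (disp 𝒱 π) i   ≡⟨ cong (λ v → + lookup x i ℤ.+ lookup v i) Δ≡c ⟩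
    + lookup x i ℤ.+ lookup (Vec.map +_ c) i ≡⟨ cong (λ w → + lookup x i ℤ.+ w) (VecP.lookup-map i +_ c) ⟩
    + lookup x i ℤ.+ + lookup c i          ≡⟨ sym (ℤP.pos-+ (lookup x i) _) ⟩
    + (lookup x i + lookup c i)            ≡⟨ cong +_ (sym (lookup-⊕ x c i)) ⟩
    + lookup (x ⊕ c) i                     ∎)
    where open ≡-Reasoning

  runRay : ∀ {π a a′ b′} {c : Vec ℕ d} → Run 𝒱 a π a′ → Run 𝒱 (a ⊕ c) π b′ →
           ∀ m → Run 𝒱 (a ⊕ m · c) π (a′ ⊕ m · c)
  runRay nil           nil           m = nil
  runRay (cons s₁ r₁) (cons s₂ r₂) m with stepRay s₁ s₂
  ... | refl , ray = cons (ray m) (runRay r₁ r₂ m)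

  runIterate : ∀ {β} (f : ℕ → Vec ℕ d) → (∀ m → Run 𝒱 (f m) β (f (suc m))) →
               ∀ k → Run 𝒱 (f 0) (β ^ₚ k) (f k)
  runIterate f step zero    = nil
  runIterate f step (suc k) = run-++ (step 0) (runIterate (λ m → f (suc m)) (λ m → step (suc m)) k)

  pump : ∀ {β x x₁ x₂} {c : Vec ℕ d} → disp 𝒱 β ≡ Vec.map +_ c →
         Run 𝒱 x β x₁ → Run 𝒱 x₁ β x₂ → ∀ k → Run 𝒱 x (β ^ₚ k) (x ⊕ k · c)
  pump {β} {x} {x₂ = x₂} {c} Δ≡c r₁ r₂ k =
    subst (λ v → Run 𝒱 v (β ^ₚ k) (x ⊕ k · c)) (ray-zero x c)
      (runIterate (λ m → x ⊕ m · c) ray k)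
    where
    r₁′ : Run 𝒱 x β (x ⊕ c)
    r₁′ = subst (Run 𝒱 x β) (runNatural Δ≡c r₁) r₁
    r₂′ : Run 𝒱 (x ⊕ c) β x₂
    r₂′ = subst (λ v → Run 𝒱 v β x₂) (runNatural Δ≡c r₁) r₂
    ray : ∀ m → Run 𝒱 (x ⊕ m · c) β (x ⊕ suc m · c)
    ray m = subst (Run 𝒱 (x ⊕ m · c) β) (ray-suc x c m) (runRay {c = c} r₁′ r₂′ m)

  boundedRuns : ∀ {β q x} → IsCycleOn 𝒱 β q → BoundedFrom 𝒱 β q x →
                ∃ λ M → ∀ k {z} → Run 𝒱 x (β ^ₚ k) z → ‖ z ‖ℕ ≤ M
  boundedRuns {β} {q} {x} cycle (L , covers) = max 0 norms , bound
    where
    norms : List ℕ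
    norms = List.map (λ rz → ‖ proj₂ rz ‖ℕ) L
    bound : ∀ k {z} → Run 𝒱 x (β ^ₚ k) z → ‖ z ‖ℕ ≤ max 0 norms
    bound k {z} r = All.lookup (xs≤max 0 norms)
      (∈-map⁺ _ (covers k (β ^ₚ k) [] q z (ListP.++-identityʳ _) (path-pow cycle k , r)))

  pumpedDisplacementZero : ∀ {β q x x₁ x₂} {c : Vec ℕ d} → IsCycleOn 𝒱 β q →
    BoundedFrom 𝒱 β q x → disp 𝒱 β ≡ Vec.map +_ c →
    Run 𝒱 x β x₁ → Run 𝒱 x₁ β x₂ → ∀ i → lookup c i ≡ 0
  pumpedDisplacementZero {x = x} {c = c} cycle bounded Δ≡c r₁ r₂ i
    with boundedRuns cycle bounded
  ... | M , bound = multiplesBounded (lookup c i) M (begin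
    suc M * lookup c i                  ≡⟨ sym (lookup-· (suc M) c i) ⟩
    lookup (suc M · c) i                ≤⟨ ℕP.m≤n+m _ (lookup x i) ⟩
    lookup x i + lookup (suc M · c) i   ≡⟨ sym (lookup-⊕ x (suc M · c) i) ⟩
    lookup (x ⊕ suc M · c) i            ≤⟨ lookup≤‖‖ℕ (x ⊕ suc M · c) i ⟩
    ‖ x ⊕ suc M · c ‖ℕ                  ≤⟨ bound (suc M) (pump Δ≡c r₁ r₂ (suc M)) ⟩
    M                                   ∎)
    where open ℕP.≤-Reasoning

  naturalCycleStationary : ∀ {β q x y n} {c : Vec ℕ d} → IsCycleOn 𝒱 β q →
    BoundedFrom 𝒱 β q x → disp 𝒱 β ≡ Vec.map +_ c → 2 ≤ n →
    Run 𝒱 x (β ^ₚ n) y → y ≡ x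
  naturalCycleStationary {β} {x = x} {y} {n} {c} cycle bounded Δ≡c (s≤s (s≤s _)) r
    with run-split β r
  ... | _ , r₁ , rest with run-split β rest
  ... | _ , r₂ , _ = vecExt λ i → ℤP.+-injective (begin
    + lookup y i                                  ≡⟨ runPow β n r i ⟩
    + lookup x i ℤ.+ + n ℤ.* lookup (disp 𝒱 β) i  ≡⟨ cong (λ D → + lookup x i ℤ.+ + n ℤ.* D) (Δ≡0 i) ⟩
    + lookup x i ℤ.+ + n ℤ.* + 0                  ≡⟨ cong (λ w → + lookup x i ℤ.+ w) (ℤP.*-zeroʳ (+ n)) ⟩
    + lookup x i ℤ.+ + 0                          ≡⟨ ℤP.+-identityʳ _ ⟩
    + lookup x i                                  ∎)
    where
    open ≡-Reasoning
    Δ≡0 : ∀ i → lookup (disp 𝒱 β) i ≡ + 0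
    Δ≡0 i = begin
      lookup (disp 𝒱 β) i       ≡⟨ cong (λ v → lookup v i) Δ≡c ⟩
      lookup (Vec.map +_ c) i   ≡⟨ VecP.lookup-map i +_ c ⟩
      + lookup c i              ≡⟨ cong +_ (pumpedDisplacementZero cycle bounded Δ≡c r₁ r₂ i) ⟩
      + 0                       ∎

  -- Case Δ(β)(j) < 0: β^n can only run if n ≤ x(j) ≤ ‖x‖, which bounds the
  -- change of every counter by ‖x‖·‖Δ(β)‖.
  decreasingCycleBound : ∀ β n {x y} j k → lookup (disp 𝒱 β) j ≡ -[1+ k ] →
    Run 𝒱 x (β ^ₚ n) y → ‖ y ‖ℕ ≤ (1 + ‖ disp 𝒱 β ‖ℤ) * ‖ x ‖ℕ
  decreasingCycleBound β n {x} {y} j k Δj≡ r = ‖‖ℕ-lub y λ i → begin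
    lookup y i                        ≤⟨ drift≤ _ _ n _ (runPow β n r i) ⟩
    lookup x i + n * ∣ lookup Δ i ∣   ≤⟨ ℕP.+-mono-≤ (lookup≤‖‖ℕ x i) (ℕP.*-mono-≤ n≤‖x‖ (∣lookup∣≤‖‖ℤ Δ i)) ⟩
    ‖ x ‖ℕ + ‖ x ‖ℕ * ‖ Δ ‖ℤ         ≡⟨ cong (λ w → ‖ x ‖ℕ + w) (ℕP.*-comm ‖ x ‖ℕ ‖ Δ ‖ℤ) ⟩
    ‖ x ‖ℕ + ‖ Δ ‖ℤ * ‖ x ‖ℕ         ∎
    where
    open ℕP.≤-Reasoning
    Δ : Vec ℤ d
    Δ = disp 𝒱 β
    n≤‖x‖ : n ≤ ‖ x ‖ℕ
    n≤‖x‖ = ℕP.≤-trans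
      (iterations≤counter _ _ n k (subst (λ D → + lookup y j ≡ + lookup x j ℤ.+ + n ℤ.* D) Δj≡ (runPow β n r j)))
      (lookup≤‖‖ℕ x j)

mainTheorem5 : ∀ {d : ℕ} (V : TVASS d) (β : Path V) (q : State V)
    (x : Vec ℕ d) → IsCycleOn V β q → BoundedFrom V β q x →
    ∀ (n : ℕ) (y : Vec ℕ d) → 2 ≤ n → Reach V q x (_^_ V β n) q y →
    ‖ y ‖ℕ ≤ (1 + ‖ disp V β ‖ℤ) * ‖ x ‖ℕ
mainTheorem5 V β q x cycle bounded n y 2≤n (_ , run) with negativeOrNatural (disp V β)
... | inj₁ (j , k , Δj≡) = decreasingCycleBound V β n j k Δj≡ run
... | inj₂ (c , Δ≡c) rewrite naturalCycleStationary V cycle bounded Δ≡c 2≤n run =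
  ℕP.m≤m+n ‖ x ‖ℕ _
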